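{- Let $F\colon\mathbb{B}^{2L}\to\mathbb{B}^{2L}$ be the Boolean Delta-Notch system over a graph $\mathcal{G}$ as in the context. For every $x\in\mathbb{B}^{2L}$ that is not a fixed point of $F$, there is a path in the asynchronous dynamics $AD_F$ from $x$ to a fixed point of $F$.
   Context: Let $L\ge 1$ and let $\mathcal{G}$ be an undirected connected graph without loops on the vertex set $C=\{1,\dots,L\}$. For $i\in C$ let $S(i)$ be the set of neighbours of $i$ in $\mathcal{G}$. $\mathbb{B}=\{0,1\}$. States of $\mathbb{B}^{2L}$ are written $(n,d)=(n_1,\dots,n_L,d_1,\dots,d_L)$. The Boolean Delta-Notch system is $F\colon\mathbb{B}^{2L}\to\mathbb{B}^{2L}$ with $F_i(n,d)=\bigvee_{j\in S(i)}d_j$ (empty disjunction $=0$) and $F_{i+L}(n,d)=1-n_i$ for $i\in C$. For a map $f\colon\mathbb{B}^m\to\mathbb{B}^m$, the asynchronous dynamics $AD_f$ is the directed graph on $\mathbb{B}^m$ with an edge from $x$ to the state obtained from $x$ by flipping coordinate $i$ whenever $f_i(x)\neq x_i$. A fixed point is $x$ with $f(x)=x$. -}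

module Defs where

open import Data.Nat using (ℕ; _+_; _≥_)
open import Data.Bool using (Bool; true; false; not; _∧_; _∨_)
open import Data.Fin using (Fin; _↑ˡ_; _↑ʳ_; _≟_; splitAt)
open import Data.Sum using (inj₁; inj₂)
open import Data.List using (List; foldr; map; allFin)
open import Relation.Nullary using (¬_; yes; no)
open import Relation.Binary.PropositionalEquality using (_≡_)
open import Relation.Binary.Construct.Closure.ReflexiveTransitive using (Star)

record Graph (L : ℕ) : Set where
  field
    adj       : Fin L → Fin L → Bool
    symmetric : ∀ i j → adj i j ≡ adj j i
    loopless  : ∀ i → adj i i ≡ false
    connected : ∀ i j → Star (λ a b → adj a b ≡ true) i j

State : ℕ → Set
State m = Fin m → Bool

flipAt : ∀ {m} → Fin m → State m → State m
flipAt i x j with i ≟ j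
... | yes _ = not (x j)
... | no  _ = x j

data ADStep {m : ℕ} (f : State m → State m) : State m → State m → Set where
  step : ∀ {x} (i : Fin m) → ¬ (f x i ≡ x i) → ADStep f x (flipAt i x)

ADPath : ∀ {m} → (State m → State m) → State m → State m → Set
ADPath f = Star (ADStep f)

IsFixed : ∀ {m} → (State m → State m) → State m → Set
IsFixed f x = ∀ i → f x i ≡ x i

nCoord : ∀ {L} → Fin L → Fin (L + L)
nCoord {L} i = i ↑ˡ L

dCoord : ∀ {L} → Fin L → Fin (L + L)
dCoord {L} i = L ↑ʳ i

or : List Bool → Bool
or = foldr _∨_ false

-- The Boolean Delta-Notch system F : B^{2L} → B^{2L}
-- F_i(n,d) = ⋁_{j ∈ S(i)} d_j,   F_{i+L}(n,d) = 1 - n_i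
deltaNotch : ∀ {L} → Graph L → State (L + L) → State (L + L)
deltaNotch {L} G x k = go (splitAt L k)
  where
  open Graph G
  go : _ → Bool
  go (inj₁ i) = or (map (λ j → adj i j ∧ x (dCoord j)) (allFin L))
  go (inj₂ i) = not (x (nCoord i))

-- A state is fixed exactly when every Notch value equals the Delta signal
-- received from the neighbours ("synced") and the cells with active Delta form
-- a maximal independent set of the graph.  Flipping an out-of-sync Notch
-- coordinate leaves Delta alone and shrinks the set of out-of-sync cells, so
-- every state can be synced.  From a synced state, switching off the Delta of a
-- cell with an active neighbour and resyncing shrinks the set of conflicting
-- cells; once Delta is independent, switching on the Delta of a cell with no
-- active neighbour and resyncing keeps it independent and shrinks the set of
-- undominated cells.  Strict inclusion of finite subsets is well founded, so
-- each phase terminates, and the last one ends in a fixed point.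
module Submission where

open import Defs
open import Data.Nat using (ℕ; _+_; _≥_)
open import Data.Bool using (Bool; true; false; not; _∧_; _xor_) renaming (_≟_ to _≟ᵇ_)
open import Data.Bool.Properties using (T-≡; T-∧; ¬-not; not-¬; not-injective; ∧-conicalˡ; ∧-conicalʳ; xor-same; not-distribˡ-xor)
open import Data.Empty using (⊥; ⊥-elim)
open import Data.Fin using (Fin; _↑ˡ_; _↑ʳ_; _≟_; splitAt; join)
open import Data.Fin.Properties using (any?; join-splitAt; splitAt-↑ˡ; splitAt-↑ʳ; ↑ˡ-injective; ↑ʳ-injective)
open import Data.Fin.Subset using (_∈_; _⊂_)
open import Data.Fin.Subset.Induction using (⊂-wellFounded)
open import Data.Bool.ListAction using (any)
open import Data.List using (allFin)
open import Data.List.Properties using (map-cong)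
open import Data.List.Membership.Propositional using (lose)
open import Data.List.Membership.Propositional.Properties using (∈-allFin)
open import Data.List.Relation.Unary.Any using (satisfied)
open import Data.List.Relation.Unary.Any.Properties using (any⁺; any⁻)
open import Data.Product using (∃; _×_; _,_)
open import Data.Sum using (_⊎_; inj₁; inj₂; [_,_])
open import Data.Vec using (tabulate)
open import Data.Vec.Properties using (lookup∘tabulate; []=⇒lookup; lookup⇒[]=)
open import Function using (_∘_; Equivalence)
open import Induction.WellFounded using (WellFounded; Acc; acc)
open import Relation.Nullary using (¬_; yes; no)
open import Relation.Binary.PropositionalEquality using (_≡_; _≢_; _≗_; refl; module ≡-Reasoning; sym; trans; cong; cong₂; subst)
open import Relation.Binary.Construct.Closure.ReflexiveTransitive using (Star; ε; _◅_; _◅◅_)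

open Equivalence using (to; from)

descend : ∀ {A B : Set} {_<_ : B → B → Set} → WellFounded _<_ → (μ : A → B) →
          {R : A → A → Set} {Q P : A → Set} →
          (∀ {x} → Q x → P x ⊎ ∃ λ y → Q y × μ y < μ x × Star R x y) →
          ∀ {x} → Q x → ∃ λ y → Q y × P y × Star R x y
descend {_<_ = _<_} wf μ {R} {Q} {P} move {x} = go x (wf (μ x))
  where
  go : ∀ x → Acc _<_ (μ x) → Q x → ∃ λ y → Q y × P y × Star R x y
  go x (acc rs) qx with move qx
  ... | inj₁ px = x , qx , px , ε
  ... | inj₂ (y , qy , y<x , x⇝y) with go y (rs y<x) qy
  ...   | z , qz , pz , y⇝z = z , qz , pz , x⇝y ◅◅ y⇝z

module _ {n : ℕ} where

  infix 4 _⊆ᵇ_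

  _⊆ᵇ_ : (Fin n → Bool) → (Fin n → Bool) → Set
  f ⊆ᵇ g = ∀ i → f i ≡ true → g i ≡ true

  someTrue? : (f : Fin n → Bool) → (∃ λ i → f i ≡ true) ⊎ (∀ i → f i ≡ false)
  someTrue? f with any? (λ i → f i ≟ᵇ true)
  ... | yes found = inj₁ found
  ... | no none = inj₂ λ i → ¬-not λ fi → none (i , fi)

  ∈-tabulate⁺ : ∀ {f : Fin n → Bool} {i} → f i ≡ true → i ∈ tabulate f
  ∈-tabulate⁺ {f} {i} fi = lookup⇒[]= i (tabulate f) (trans (lookup∘tabulate f i) fi)

  ∈-tabulate⁻ : ∀ {f : Fin n → Bool} {i} → i ∈ tabulate f → f i ≡ true
  ∈-tabulate⁻ {f} {i} i∈f = trans (sym (lookup∘tabulate f i)) ([]=⇒lookup i∈f)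

  tabulate-⊂ : ∀ {f g : Fin n → Bool} {i} → f ⊆ᵇ g → f i ≡ false → g i ≡ true →
               tabulate f ⊂ tabulate g
  tabulate-⊂ {i = i} f⊆g fi gi =
    (λ j∈f → ∈-tabulate⁺ (f⊆g _ (∈-tabulate⁻ j∈f))) , i , ∈-tabulate⁺ gi , i∉f
    where
    i∉f : ¬ i ∈ _
    i∉f i∈f with trans (sym fi) (∈-tabulate⁻ i∈f)
    ... | ()

  module _ {w w′ : Fin n → Bool} {i : Fin n} (off-i : ∀ j → i ≢ j → w′ j ≡ w j) where

    removal-⊆ᵇ : w′ i ≡ false → w′ ⊆ᵇ w
    removal-⊆ᵇ w′i j w′j with i ≟ j
    ... | no i≢j = trans (sym (off-i j i≢j)) w′j
    ... | yes refl with trans (sym w′i) w′j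
    ...   | ()

    insertion-⊆ᵇ : w′ i ≡ true → w ⊆ᵇ w′
    insertion-⊆ᵇ w′i j wj with i ≟ j
    ... | yes refl = w′i
    ... | no i≢j = trans (off-i j i≢j) wj

∧-mono : ∀ {a b a′ b′} → (a ≡ true → a′ ≡ true) → (b ≡ true → b′ ≡ true) →
         a ∧ b ≡ true → a′ ∧ b′ ≡ true
∧-mono a⇒a′ b⇒b′ ab = cong₂ _∧_ (a⇒a′ (∧-conicalˡ _ _ ab)) (b⇒b′ (∧-conicalʳ _ _ ab))

not-antitone : ∀ {a b} → (a ≡ true → b ≡ true) → not b ≡ true → not a ≡ true
not-antitone {false} _ _ = refl
not-antitone {true} a⇒b nb with a⇒b refl
not-antitone {true} a⇒b () | refl

xor≡false⇒≡ : ∀ {a b} → a xor b ≡ false → a ≡ b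
xor≡false⇒≡ {true} {true} _ = refl
xor≡false⇒≡ {false} {false} _ = refl

complementary : ∀ {a b} → a ∧ b ≡ false → not a ∧ not b ≡ false → not b ≡ a
complementary {true} {false} _ _ = refl
complementary {false} {true} _ _ = refl

flipAt-self : ∀ {m} (k : Fin m) (x : State m) → flipAt k x k ≡ not (x k)
flipAt-self k x with k ≟ k
... | yes _ = refl
... | no k≢k = ⊥-elim (k≢k refl)

flipAt-other : ∀ {m} {k k′ : Fin m} (x : State m) → k ≢ k′ → flipAt k x k′ ≡ x k′
flipAt-other {k = k} {k′} x k≢k′ with k ≟ k′
... | no _ = refl
... | yes k≡k′ = ⊥-elim (k≢k′ k≡k′)

↑ˡ≢↑ʳ : ∀ {m n} (i : Fin m) (j : Fin n) → i ↑ˡ n ≢ m ↑ʳ j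
↑ˡ≢↑ʳ {m} {n} i j e with trans (sym (splitAt-↑ˡ m i n)) (trans (cong (splitAt m) e) (splitAt-↑ʳ m n j))
... | ()

∀-↑ˡ-↑ʳ : ∀ {m n} {P : Fin (m + n) → Set} → (∀ i → P (i ↑ˡ n)) → (∀ j → P (m ↑ʳ j)) → ∀ k → P k
∀-↑ˡ-↑ʳ {m} {n} {P} pˡ pʳ k = subst P (join-splitAt m n k) ([_,_] {C = P ∘ join m n} pˡ pʳ (splitAt m k))

module _ {L : ℕ} (G : Graph L) where
  open Graph G

  anyNeighbour : (Fin L → Bool) → Fin L → Bool
  anyNeighbour w i = any (λ j → adj i j ∧ w j) (allFin L)

  anyNeighbour⁺ : ∀ {w i j} → adj i j ≡ true → w j ≡ true → anyNeighbour w i ≡ true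
  anyNeighbour⁺ {j = j} aij wj =
    to T-≡ (any⁺ _ (lose (∈-allFin j) (from T-≡ (cong₂ _∧_ aij wj))))

  anyNeighbour⁻ : ∀ {w i} → anyNeighbour w i ≡ true → ∃ λ j → adj i j ≡ true × w j ≡ true
  anyNeighbour⁻ e with satisfied (any⁻ _ (allFin L) (from T-≡ e))
  ... | j , t with to T-∧ t
  ...   | aij , wj = j , to T-≡ aij , to T-≡ wj

  anyNeighbour-mono : ∀ {w w′} → w ⊆ᵇ w′ → anyNeighbour w ⊆ᵇ anyNeighbour w′
  anyNeighbour-mono w⊆w′ i e with anyNeighbour⁻ e
  ... | j , aij , wj = anyNeighbour⁺ aij (w⊆w′ j wj)

  anyNeighbour-cong : ∀ {w w′} → w ≗ w′ → anyNeighbour w ≗ anyNeighbour w′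
  anyNeighbour-cong w≗w′ i = cong or (map-cong (λ j → cong (adj i j ∧_) (w≗w′ j)) (allFin L))

  conflict undominated : (Fin L → Bool) → Fin L → Bool
  conflict w i = w i ∧ anyNeighbour w i
  undominated w i = not (w i) ∧ not (anyNeighbour w i)

  Independent : (Fin L → Bool) → Set
  Independent w = ∀ i → conflict w i ≡ false

  conflict-⊂ : ∀ {w w′ i} → w′ ⊆ᵇ w → w′ i ≡ false → conflict w i ≡ true →
               tabulate (conflict w′) ⊂ tabulate (conflict w)
  conflict-⊂ {w′ = w′} {i} w′⊆w w′i c =
    tabulate-⊂ (λ j → ∧-mono (w′⊆w j) (anyNeighbour-mono w′⊆w j))
               (cong (_∧ anyNeighbour w′ i) w′i) c

  undominated-⊂ : ∀ {w w′ i} → w ⊆ᵇ w′ → w′ i ≡ true → undominated w i ≡ true →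
                  tabulate (undominated w′) ⊂ tabulate (undominated w)
  undominated-⊂ {w′ = w′} {i} w⊆w′ w′i u =
    tabulate-⊂ (λ j → ∧-mono (not-antitone (w⊆w′ j)) (not-antitone (anyNeighbour-mono w⊆w′ j)))
               (cong (λ b → not b ∧ not (anyNeighbour w′ i)) w′i) u

  undominated⇒absent : ∀ {w i} → undominated w i ≡ true → w i ≡ false
  undominated⇒absent u = not-injective {y = false} (∧-conicalˡ _ _ u)

  undominated⇒isolated : ∀ {w i} → undominated w i ≡ true → anyNeighbour w i ≡ false
  undominated⇒isolated u = not-injective {y = false} (∧-conicalʳ _ _ u)

  undominated-noNeighbour : ∀ {w i j} → undominated w i ≡ true → adj i j ≡ true → w j ≡ true → ⊥
  undominated-noNeighbour u aij wj with trans (sym (undominated⇒isolated u)) (anyNeighbour⁺ aij wj)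
  ... | ()

  insert-independent : ∀ {w w′ i} → Independent w → undominated w i ≡ true →
                       (∀ j → i ≢ j → w′ j ≡ w j) → Independent w′
  insert-independent {w} {w′} {i} ind u off-i j = ¬-not noConflict
    where
    noConflict : conflict w′ j ≢ true
    noConflict c with anyNeighbour⁻ (∧-conicalʳ _ _ c)
    ... | k , ajk , w′k with i ≟ j | i ≟ k
    ... | yes refl | yes refl with trans (sym (loopless i)) ajk
    ...   | ()
    noConflict c | k , ajk , w′k | yes refl | no i≢k =
      undominated-noNeighbour u ajk (trans (sym (off-i k i≢k)) w′k)
    noConflict c | k , ajk , w′k | no i≢j | yes refl =
      undominated-noNeighbour u (trans (symmetric i j) ajk)
        (trans (sym (off-i j i≢j)) (∧-conicalˡ _ _ c))
    noConflict c | k , ajk , w′k | no i≢j | no i≢k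
      with trans (sym (ind j))
             (cong₂ _∧_ (trans (sym (off-i j i≢j)) (∧-conicalˡ _ _ c))
                        (anyNeighbour⁺ ajk (trans (sym (off-i k i≢k)) w′k)))
    ... | ()

  F : State (L + L) → State (L + L)
  F = deltaNotch G

  notch delta : State (L + L) → Fin L → Bool
  notch x i = x (nCoord i)
  delta x i = x (dCoord i)

  F-notch : ∀ x i → F x (nCoord i) ≡ anyNeighbour (delta x) i
  F-notch x i rewrite splitAt-↑ˡ L i L = refl

  F-delta : ∀ x i → F x (dCoord i) ≡ not (notch x i)
  F-delta x i rewrite splitAt-↑ʳ L L i = refl

  Synced : State (L + L) → Set
  Synced x = ∀ i → notch x i ≡ anyNeighbour (delta x) i

  unsynced : State (L + L) → Fin L → Bool
  unsynced x i = notch x i xor anyNeighbour (delta x) i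

  module _ (x : State (L + L)) (i : Fin L) where

    delta-flipNotch : delta (flipAt (nCoord i) x) ≗ delta x
    delta-flipNotch j = flipAt-other x (↑ˡ≢↑ʳ i j)

    unsynced-flipNotch-self : unsynced x i ≡ true → unsynced (flipAt (nCoord i) x) i ≡ false
    unsynced-flipNotch-self u = begin
      unsynced (flipAt (nCoord i) x) i
        ≡⟨ cong₂ _xor_ (flipAt-self (nCoord i) x) (anyNeighbour-cong delta-flipNotch i) ⟩
      not (notch x i) xor anyNeighbour (delta x) i
        ≡⟨ sym (not-distribˡ-xor (notch x i) (anyNeighbour (delta x) i)) ⟩
      not (unsynced x i)
        ≡⟨ cong not u ⟩
      false ∎
      where open ≡-Reasoning

    unsynced-flipNotch-other : ∀ j → i ≢ j → unsynced (flipAt (nCoord i) x) j ≡ unsynced x j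
    unsynced-flipNotch-other j i≢j =
      cong₂ _xor_ (flipAt-other x (i≢j ∘ ↑ˡ-injective L i j)) (anyNeighbour-cong delta-flipNotch j)

    delta-flipDelta-other : ∀ j → i ≢ j → delta (flipAt (dCoord i) x) j ≡ delta x j
    delta-flipDelta-other j i≢j = flipAt-other x (i≢j ∘ ↑ʳ-injective L i j)

  sync : ∀ x → ∃ λ y → (delta y ≗ delta x) × Synced y × ADPath F x y
  sync x = descend ⊂-wellFounded (tabulate ∘ unsynced) move (λ _ → refl)
    where
    move : ∀ {y} → delta y ≗ delta x → Synced y ⊎
           ∃ λ y′ → delta y′ ≗ delta x × tabulate (unsynced y′) ⊂ tabulate (unsynced y) × ADPath F y y′
    move {y} y≗x with someTrue? (unsynced y)
    ... | inj₂ synced = inj₁ λ i → xor≡false⇒≡ (synced i)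
    ... | inj₁ (i , u) = inj₂
      ( flipAt (nCoord i) y
      , (λ j → trans (delta-flipNotch y i j) (y≗x j))
      , tabulate-⊂ (removal-⊆ᵇ (unsynced-flipNotch-other y i) fixed-i) fixed-i u
      , step (nCoord i) disagrees ◅ ε )
      where
      fixed-i : unsynced (flipAt (nCoord i) y) i ≡ false
      fixed-i = unsynced-flipNotch-self y i u

      disagrees : F y (nCoord i) ≢ notch y i
      disagrees e with trans (sym u) (trans (cong (_xor N) (trans (sym e) (F-notch y i))) (xor-same N))
        where N = anyNeighbour (delta y) i
      ... | ()

  flipDelta-sync : ∀ x i → Synced x → delta x i ≡ anyNeighbour (delta x) i →
                   ∃ λ y → Synced y × delta y i ≡ not (delta x i) ×
                           (∀ j → i ≢ j → delta y j ≡ delta x j) × ADPath F x y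
  flipDelta-sync x i sx dx≡N with sync (flipAt (dCoord i) x)
  ... | y , y≗x′ , sy , x′⇝y =
    y , sy , trans (y≗x′ i) (flipAt-self (dCoord i) x)
      , (λ j i≢j → trans (y≗x′ j) (delta-flipDelta-other x i j i≢j))
      , step (dCoord i) disagrees ◅ x′⇝y
    where
    disagrees : F x (dCoord i) ≢ delta x i
    disagrees e = not-¬ refl (trans (sym e) (trans (F-delta x i) (cong not (trans (sx i) (sym dx≡N)))))

  removeConflicts : ∀ {x} → Synced x → ∃ λ y → Synced y × Independent (delta y) × ADPath F x y
  removeConflicts = descend ⊂-wellFounded (tabulate ∘ conflict ∘ delta) move
    where
    move : ∀ {x} → Synced x → Independent (delta x) ⊎
           ∃ λ y → Synced y × tabulate (conflict (delta y)) ⊂ tabulate (conflict (delta x)) × ADPath F x y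
    move {x} sx with someTrue? (conflict (delta x))
    ... | inj₂ ind = inj₁ ind
    ... | inj₁ (i , c) with flipDelta-sync x i sx (trans (∧-conicalˡ _ _ c) (sym (∧-conicalʳ _ _ c)))
    ...   | y , sy , yi , off-i , x⇝y = inj₂ (y , sy , conflict-⊂ (removal-⊆ᵇ off-i yi′) yi′ c , x⇝y)
      where
      yi′ : delta y i ≡ false
      yi′ = trans yi (cong not (∧-conicalˡ _ _ c))

  addUndominated : ∀ {x} → Synced x × Independent (delta x) →
                   ∃ λ y → (Synced y × Independent (delta y)) ×
                           (∀ i → undominated (delta y) i ≡ false) × ADPath F x y
  addUndominated = descend ⊂-wellFounded (tabulate ∘ undominated ∘ delta) move
    where
    move : ∀ {x} → Synced x × Independent (delta x) → (∀ i → undominated (delta x) i ≡ false) ⊎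
           ∃ λ y → (Synced y × Independent (delta y)) ×
                   tabulate (undominated (delta y)) ⊂ tabulate (undominated (delta x)) × ADPath F x y
    move {x} (sx , ind) with someTrue? (undominated (delta x))
    ... | inj₂ dominated = inj₁ dominated
    ... | inj₁ (i , u)
      with flipDelta-sync x i sx (trans (undominated⇒absent u) (sym (undominated⇒isolated u)))
    ...   | y , sy , yi , off-i , x⇝y =
      inj₂ (y , (sy , insert-independent ind u off-i) , undominated-⊂ (insertion-⊆ᵇ off-i yi′) yi′ u , x⇝y)
      where
      yi′ : delta y i ≡ true
      yi′ = trans yi (cong not (undominated⇒absent u))

  synced-maximalIndependent⇒fixed : ∀ {x} → Synced x → Independent (delta x) →
                                    (∀ i → undominated (delta x) i ≡ false) → IsFixed F x
  synced-maximalIndependent⇒fixed {x} sx ind dom = ∀-↑ˡ-↑ʳ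
    (λ i → trans (F-notch x i) (sym (sx i)))
    (λ i → trans (F-delta x i) (trans (cong not (sx i)) (complementary (ind i) (dom i))))

theorem4 : (L : ℕ) → L ≥ 1 → (G : Graph L) → (x : State (L + L)) →
    ¬ IsFixed (deltaNotch G) x →
    ∃ λ y → IsFixed (deltaNotch G) y × ADPath (deltaNotch G) x y
theorem4 L _ G x _ with sync G x
... | x₁ , _ , s₁ , x⇝x₁ with removeConflicts G s₁
... | x₂ , s₂ , ind₂ , x₁⇝x₂ with addUndominated G (s₂ , ind₂)
... | y , (s , ind) , dom , x₂⇝y =
  y , synced-maximalIndependent⇒fixed G s ind dom , x⇝x₁ ◅◅ x₁⇝x₂ ◅◅ x₂⇝y
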